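{- Let $\mathcal{P}=\{2413, 2431, 4213, 3412, 3421, 4231, 4321, 4312\}$, let $I_k=12\cdots k$, and let $n\geq 5$. There are exactly $n-4$ inflations of $41352$ of length $n$ avoiding $\mathcal{P}$, namely $41352[1, I_\ell, 1, I_{n-\ell-3}, 1]$ for $\ell\in[n-4]$.
   Context: For a $k$-permutation $\sigma$ and permutations $\alpha^{(1)},\dots,\alpha^{(k)}$, the inflation $\sigma[\alpha^{(1)},\dots,\alpha^{(k)}]$ replaces each entry $\sigma_\ell$ by a block of consecutive positions order-isomorphic to $\alpha^{(\ell)}$ whose values form an interval, the blocks being ordered relative to each other as the entries of $\sigma$. Pattern containment is the usual order-isomorphic subsequence containment. -}

module Defs where

open import Data.Nat using (ℕ; zero; suc; _+_; _<_; _<?_; _≤_; _∸_)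
open import Data.List using (List; []; _∷_; length; map; upTo; zip; filter; concat; lookup)
open import Data.Nat.ListAction using (sum)
open import Data.List.Relation.Binary.Permutation.Propositional using (_↭_)
open import Data.List.Relation.Binary.Sublist.Propositional using (_⊆_)
open import Data.List.Relation.Unary.All using (All)
open import Data.List.Membership.Propositional using (_∈_)
open import Data.Fin using (Fin; cast)
open import Data.Product using (Σ; ∃; _×_; _,_; proj₁; proj₂)
open import Relation.Binary.PropositionalEquality using (_≡_; _≢_)
open import Relation.Nullary using (¬_)
open import Function using (_∘_)

-- Permutations are lists of naturals; a permutation of length n is a
-- rearrangement of 1, 2, ..., n (one-line notation).
Perm : Set
Perm = List ℕ

I : ℕ → Perm
I k = map suc (upTo k)

IsPerm : Perm → Set
IsPerm π = π ↭ I (length π)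

OrderIso : List ℕ → List ℕ → Set
OrderIso xs ys = Σ (length xs ≡ length ys) λ eq →
  ∀ (i j : Fin (length xs)) →
    ((lookup xs i < lookup xs j) → (lookup ys (cast eq i) < lookup ys (cast eq j))) ×
    ((lookup ys (cast eq i) < lookup ys (cast eq j)) → (lookup xs i < lookup xs j))

Contains : Perm → Perm → Set
Contains π σ = ∃ λ (τ : List ℕ) → (τ ⊆ π) × OrderIso τ σ

Avoids : Perm → Perm → Set
Avoids π σ = ¬ Contains π σ

AvoidsAll : Perm → List Perm → Set
AvoidsAll π ps = ∀ σ → σ ∈ ps → Avoids π σ

-- Inflation σ[α⁽¹⁾, …, α⁽ᵏ⁾]: block ℓ is α⁽ℓ⁾ shifted up by the total
-- length of the blocks α⁽ʲ⁾ with σⱼ < σ_ℓ.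
offset : List (ℕ × Perm) → ℕ → ℕ
offset ps s = sum (map (length ∘ proj₂) (filter (λ p → proj₁ p <? s) ps))

inflate : Perm → List Perm → Perm
inflate σ αs = concat (map (λ p → map (_+ offset ps (proj₁ p)) (proj₂ p)) ps)
  where ps = zip σ αs

NonEmpty : Perm → Set
NonEmpty α = α ≢ []

IsInflationOf : Perm → Perm → Set
IsInflationOf σ π = ∃ λ (αs : List Perm) →
  (length αs ≡ length σ) × All IsPerm αs × All NonEmpty αs × (π ≡ inflate σ αs)

σ41352 : Perm
σ41352 = 4 ∷ 1 ∷ 3 ∷ 5 ∷ 2 ∷ []

𝒫 : List Perm
𝒫 = (2 ∷ 4 ∷ 1 ∷ 3 ∷ []) ∷ (2 ∷ 4 ∷ 3 ∷ 1 ∷ []) ∷ (4 ∷ 2 ∷ 1 ∷ 3 ∷ []) ∷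
    (3 ∷ 4 ∷ 1 ∷ 2 ∷ []) ∷ (3 ∷ 4 ∷ 2 ∷ 1 ∷ []) ∷ (4 ∷ 2 ∷ 3 ∷ 1 ∷ []) ∷
    (4 ∷ 3 ∷ 2 ∷ 1 ∷ []) ∷ (4 ∷ 3 ∷ 1 ∷ 2 ∷ []) ∷ []

special : ℕ → ℕ → Perm
special n ℓ = inflate σ41352 (I 1 ∷ I ℓ ∷ I 1 ∷ I (n ∸ ℓ ∸ 3) ∷ I 1 ∷ [])

-- In π = 41352[α₁, α₂, α₃, α₄, α₅] the blocks lie, from bottom to top, in the order
-- α₂, α₅, α₃, α₁, α₄. Two entries of α₁ together with one entry each of α₂ and α₃ form 3412 or
-- 4312; two entries of α₃ with entries of α₁ and α₅ form 4231 or 4321; two entries of α₅ with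
-- entries of α₁ and α₃ form 4312 or 4321; a descent in α₂ gives 4213 and a descent in α₄ gives
-- 2431. So if π avoids 𝒫, then α₁ = α₃ = α₅ = 1 and α₂, α₄ are increasing, which pins π down as
-- 41352[1, I_ℓ, 1, I_(n-ℓ-3), 1].
-- Conversely, such a permutation has the form a U c with U increasing and a = c + 2. Every
-- occurrence of a pattern of 𝒫 in it ascends from its second to its third entry, which no
-- pattern of 𝒫 does except 4231; and an occurrence of 4231 must start at a and end at c,
-- squeezing two values strictly between c and c + 2.

module Submission where

open import Defs
open import Data.Empty using (⊥-elim)
open import Data.Fin as Fin using (Fin; cast; #_)
import Data.List as List
open import Data.List using (List; []; _∷_; _++_; map; length; lookup; upTo; applyUpTo)
open import Data.List.Properties using (length-map; length-upTo; map-upTo; ++-assoc; ∷-injectiveˡ)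
open import Data.List.Membership.Propositional using (_∈_)
open import Data.List.Membership.Propositional.Properties using (∈-lookup; ∈-map⁻; ∈-upTo⁻; ∈-++⁻)
open import Data.List.Relation.Unary.Any using (here; there)
open import Data.List.Relation.Unary.All as All using (All; []; _∷_; all?)
open import Data.List.Relation.Unary.AllPairs using (AllPairs; []; _∷_)
import Data.List.Relation.Unary.AllPairs.Properties as AllPairs
open import Data.List.Relation.Unary.Linked as Linked using (Linked; []; [-]; _∷_)
open import Data.List.Relation.Unary.Linked.Properties using (AllPairs⇒Linked)
open import Data.List.Relation.Unary.Sorted.TotalOrder.Properties using (↗↭↗⇒≋)
open import Data.List.Relation.Binary.Pointwise using (Pointwise-≡⇒≡)
open import Data.List.Relation.Binary.Sublist.Propositional
  using (_⊆_; []; _∷_; _∷ʳ_; ⊆-refl; ⊆-trans; minimum; from∈; to∈)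
open import Data.List.Relation.Binary.Sublist.Propositional.Properties using (++⁺; map⁺; ∷ˡ⁻)
open import Data.List.Relation.Binary.Permutation.Propositional
  using (_↭_; ↭-refl; ↭-sym; ↭-trans; ↭-prep; ↭-swap; ↭⇒↭ₛ)
open import Data.List.Relation.Binary.Permutation.Propositional.Properties
  using (↭-length; ∈-resp-↭; shift; ∷↭∷ʳ; ++⁺ˡ)
open import Data.Nat
open import Data.Nat.Properties
open import Algebra.Properties.CommutativeSemigroup +-commutativeSemigroup using (x∙yz≈y∙xz)
open import Data.Product using (∃; ∃₂; _×_; _,_; proj₁; proj₂)
open import Data.Sum using (_⊎_; inj₁; inj₂)
open import Function using (_∘_)
open import Relation.Binary.Definitions using (tri<; tri≈; tri>)
open import Relation.Binary.PropositionalEquality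
open import Relation.Nullary using (¬_; yes; no)
open import Relation.Nullary.Decidable using (True; toWitness; from-yes; _×-dec_)

interval : ℕ → ℕ → List ℕ
interval a zero    = []
interval a (suc k) = suc a ∷ interval (suc a) k

applyUpTo-interval : ∀ (f : ℕ → ℕ) a k → (∀ i → f i ≡ suc (a + i)) → applyUpTo f k ≡ interval a k
applyUpTo-interval f a zero    f≗ = refl
applyUpTo-interval f a (suc k) f≗ = cong₂ _∷_
  (trans (f≗ 0) (cong suc (+-identityʳ a)))
  (applyUpTo-interval (f ∘ suc) (suc a) k (λ i → trans (f≗ (suc i)) (cong suc (+-suc a i))))

I≡interval : ∀ k → I k ≡ interval 0 k
I≡interval k = trans (map-upTo suc k) (applyUpTo-interval suc 0 k (λ _ → refl))

length-I : ∀ k → length (I k) ≡ k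
length-I k = trans (length-map suc (upTo k)) (length-upTo k)

map-+-interval : ∀ o a k → map (_+ o) (interval a k) ≡ interval (a + o) k
map-+-interval o a zero    = refl
map-+-interval o a (suc k) = cong (suc (a + o) ∷_) (map-+-interval o (suc a) k)

interval-++ : ∀ a j k → interval a (j + k) ≡ interval a j ++ interval (a + j) k
interval-++ a zero    k = cong (λ b → interval b k) (sym (+-identityʳ a))
interval-++ a (suc j) k = cong (suc a ∷_) (trans (interval-++ (suc a) j k)
  (cong (λ b → interval (suc a) j ++ interval b k) (sym (+-suc a j))))

∈-interval⁻ : ∀ {x} a k → x ∈ interval a k → a < x × x ≤ a + k
∈-interval⁻ a (suc k) (here refl) = ≤-refl , ≤-trans (s≤s (m≤m+n a k)) (≤-reflexive (sym (+-suc a k)))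
∈-interval⁻ a (suc k) (there x∈) with ∈-interval⁻ (suc a) k x∈
... | a<x , x≤ = <⇒≤ a<x , ≤-trans x≤ (≤-reflexive (sym (+-suc a k)))

interval-increasing : ∀ a k → AllPairs _<_ (interval a k)
interval-increasing a zero    = []
interval-increasing a (suc k) =
  All.tabulate (proj₁ ∘ ∈-interval⁻ (suc a) k) ∷ interval-increasing (suc a) k

I-isPerm : ∀ k → IsPerm (I k)
I-isPerm k = subst (λ j → I k ↭ I j) (sym (length-I k)) ↭-refl

I-nonEmpty : ∀ {k} → 1 ≤ k → NonEmpty (I k)
I-nonEmpty (s≤s _) ()

I-sorted : ∀ k → Linked _≤_ (I k)
I-sorted k = subst (Linked _≤_) (sym (I≡interval k))
  (Linked.map <⇒≤ (AllPairs⇒Linked (interval-increasing 0 k)))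

nonEmpty-length : ∀ {α : Perm} → NonEmpty α → 1 ≤ length α
nonEmpty-length {[]}    ne = ⊥-elim (ne refl)
nonEmpty-length {_ ∷ _} _  = s≤s z≤n

entry : ∀ {α : Perm} → NonEmpty α → ∃ (_∈ α)
entry {[]}    ne = ⊥-elim (ne refl)
entry {x ∷ _} _  = x , here refl

perm-bounds : ∀ {α x} → IsPerm α → x ∈ α → 0 < x × x ≤ length α
perm-bounds p x∈α with ∈-map⁻ suc (∈-resp-↭ p x∈α)
... | i , i∈upTo , refl = s≤s z≤n , ∈-upTo⁻ i∈upTo

Ascent Inversion : List ℕ → Set
Ascent    α = ∃₂ λ u v → (u ∷ v ∷ []) ⊆ α × u < v
Inversion α = ∃₂ λ u v → (u ∷ v ∷ []) ⊆ α × v < u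

sorted-or-inversion : ∀ α → Linked _≤_ α ⊎ Inversion α
sorted-or-inversion []       = inj₁ []
sorted-or-inversion (x ∷ [])  = inj₁ [-]
sorted-or-inversion (x ∷ y ∷ α) with x ≤? y | sorted-or-inversion (y ∷ α)
... | no x≰y  | _                          = inj₂ (x , y , refl ∷ refl ∷ minimum α , ≰⇒> x≰y)
... | yes x≤y | inj₁ yα↗                  = inj₁ (x≤y ∷ yα↗)
... | yes _   | inj₂ (u , v , uv⊆yα , v<u) = inj₂ (u , v , x ∷ʳ uv⊆yα , v<u)

perm-without-inversion : ∀ {α} → IsPerm α → ¬ Inversion α → α ≡ I (length α)
perm-without-inversion {α} p ¬inv with sorted-or-inversion α
... | inj₁ α↗  = Pointwise-≡⇒≡ (↗↭↗⇒≋ ≤-totalOrder α↗ (I-sorted (length α)) (↭⇒↭ₛ p))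
... | inj₂ inv = ⊥-elim (¬inv inv)

perm-singleton : ∀ {α} → IsPerm α → NonEmpty α → ¬ Ascent α → ¬ Inversion α → α ≡ I 1
perm-singleton {α} p ne ¬asc ¬inv with length α | perm-without-inversion p ¬inv
... | 0           | α≡[]  = ⊥-elim (ne α≡[])
... | 1           | α≡I1  = α≡I1
... | suc (suc k) | refl  = ⊥-elim (¬asc (1 , 2 , refl ∷ refl ∷ minimum _ , ≤-refl))

block-< : ∀ {α β x y o o′} → IsPerm α → IsPerm β → x ∈ α → y ∈ β →
  length α + o ≤ o′ → x + o < y + o′
block-< {α} {β} {x} {y} {o} {o′} p q x∈α y∈β gap = begin-strict
  x + o        ≤⟨ +-monoˡ-≤ o (proj₂ (perm-bounds p x∈α)) ⟩
  length α + o ≤⟨ gap ⟩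
  o′           <⟨ +-monoˡ-< o′ (proj₁ (perm-bounds q y∈β)) ⟩
  y + o′       ∎
  where open ≤-Reasoning

-- cast ignores its (irrelevant) proof argument, so the recursive call needs no transport.
lookup-map : ∀ (f : ℕ → ℕ) xs i → lookup (map f xs) i ≡ f (lookup xs (cast (length-map f xs) i))
lookup-map f (x ∷ xs) Fin.zero    = refl
lookup-map f (x ∷ xs) (Fin.suc i) = lookup-map f xs i

<-reflected : ∀ {f : ℕ → ℕ} {a b} → (b < a → f b < f a) → f a < f b → a < b
<-reflected {a = a} {b} mono fa<fb with <-cmp a b
... | tri< a<b _ _  = a<b
... | tri≈ _ refl _ = ⊥-elim (<-irrefl refl fa<fb)
... | tri> _ _ b<a  = ⊥-elim (<-asym fa<fb (mono b<a))

OrderIso-map : ∀ (f : ℕ → ℕ) σ → (∀ {a b} → a ∈ σ → b ∈ σ → a < b → f a < f b) →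
  OrderIso (map f σ) σ
OrderIso-map f σ mono = length-map f σ , comparisons
  where
  σ[_] : Fin (length (map f σ)) → ℕ
  σ[ i ] = lookup σ (cast (length-map f σ) i)

  comparisons : ∀ i j →
    (lookup (map f σ) i < lookup (map f σ) j → σ[ i ] < σ[ j ]) ×
    (σ[ i ] < σ[ j ] → lookup (map f σ) i < lookup (map f σ) j)
  comparisons i j rewrite lookup-map f σ i | lookup-map f σ j =
    <-reflected {f} (mono (∈-lookup _) (∈-lookup _)) , mono (∈-lookup _) (∈-lookup _)

OrderIso-< : ∀ {τ σ} (τ≅σ : OrderIso τ σ) (i j : Fin (length τ)) →
  {True (lookup σ (cast (proj₁ τ≅σ) i) <? lookup σ (cast (proj₁ τ≅σ) j))} →
  lookup τ i < lookup τ j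
OrderIso-< (_ , comparisons) i j {σᵢ<σⱼ} = proj₂ (comparisons i j) (toWitness σᵢ<σⱼ)

-- map (pick w₁ w₂ w₃ w₄) σ is the occurrence of a pattern σ of length 4 whose values,
-- in increasing order, are w₁, w₂, w₃, w₄.
pick : ℕ → ℕ → ℕ → ℕ → ℕ → ℕ
pick w₁ w₂ w₃ w₄ 1 = w₁
pick w₁ w₂ w₃ w₄ 2 = w₂
pick w₁ w₂ w₃ w₄ 3 = w₃
pick w₁ w₂ w₃ w₄ _ = w₄

stepwise-mono : ∀ {f : ℕ → ℕ} {lo hi a b} → (∀ {k} → lo ≤ k → suc k ≤ hi → f k < f (suc k)) →
  lo ≤ a → a < b → b ≤ hi → f a < f b
stepwise-mono {b = suc b} step lo≤a (s≤s a≤b) b<hi with m≤n⇒m<n∨m≡n a≤b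
... | inj₂ refl = step lo≤a b<hi
... | inj₁ a<b  = <-trans (stepwise-mono step lo≤a a<b (<⇒≤ b<hi)) (step (≤-trans lo≤a (<⇒≤ a<b)) b<hi)

pick-step : ∀ {w₁ w₂ w₃ w₄ k} → w₁ < w₂ → w₂ < w₃ → w₃ < w₄ →
  1 ≤ k → suc k ≤ 4 → pick w₁ w₂ w₃ w₄ k < pick w₁ w₂ w₃ w₄ (suc k)
pick-step {k = 1} p q r _ _ = p
pick-step {k = 2} p q r _ _ = q
pick-step {k = 3} p q r _ _ = r
pick-step {k = 0} _ _ _ () _
pick-step {k = suc (suc (suc (suc _)))} _ _ _ _ (s≤s (s≤s (s≤s (s≤s ()))))

𝒫-lengths : ∀ {σ} → σ ∈ 𝒫 → length σ ≡ 4
𝒫-lengths = All.lookup (from-yes (all? (λ σ → length σ ≟ 4) 𝒫))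

𝒫-entries : ∀ {σ a} → σ ∈ 𝒫 → a ∈ σ → 1 ≤ a × a ≤ 4
𝒫-entries σ∈𝒫 = All.lookup (All.lookup (from-yes (all? (all? (λ a → 1 ≤? a ×-dec a ≤? 4)) 𝒫)) σ∈𝒫)

pattern 2413∈𝒫 = here refl
pattern 2431∈𝒫 = there (here refl)
pattern 4213∈𝒫 = there (there (here refl))
pattern 3412∈𝒫 = there (there (there (here refl)))
pattern 3421∈𝒫 = there (there (there (there (here refl))))
pattern 4231∈𝒫 = there (there (there (there (there (here refl)))))
pattern 4321∈𝒫 = there (there (there (there (there (there (here refl))))))
pattern 4312∈𝒫 = there (there (there (there (there (there (there (here refl)))))))

¬occurrence : ∀ {π σ w₁ w₂ w₃ w₄} → AvoidsAll π 𝒫 → σ ∈ 𝒫 →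
  w₁ < w₂ → w₂ < w₃ → w₃ < w₄ → ¬ (map (pick w₁ w₂ w₃ w₄) σ ⊆ π)
¬occurrence {σ = σ} {w₁} {w₂} {w₃} {w₄} avoids σ∈𝒫 w₁<w₂ w₂<w₃ w₃<w₄ occ =
  avoids σ σ∈𝒫 (_ , occ , OrderIso-map _ σ mono)
  where
  mono : ∀ {a b} → a ∈ σ → b ∈ σ → a < b → pick w₁ w₂ w₃ w₄ a < pick w₁ w₂ w₃ w₄ b
  mono a∈σ b∈σ a<b = stepwise-mono (pick-step w₁<w₂ w₂<w₃ w₃<w₄)
    (proj₁ (𝒫-entries σ∈𝒫 a∈σ)) a<b (proj₂ (𝒫-entries σ∈𝒫 b∈σ))

avoids-length-4 : ∀ {π σ} → length σ ≡ 4 →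
  (∀ {x₀ x₁ x₂ x₃} → (x₀ ∷ x₁ ∷ x₂ ∷ x₃ ∷ []) ⊆ π → ¬ OrderIso (x₀ ∷ x₁ ∷ x₂ ∷ x₃ ∷ []) σ) →
  Avoids π σ
avoids-length-4 {π} {σ} |σ|≡4 no-occurrence (τ , τ⊆π , τ≅σ) = go τ (trans (proj₁ τ≅σ) |σ|≡4) τ⊆π τ≅σ
  where
  go : ∀ τ → length τ ≡ 4 → τ ⊆ π → ¬ OrderIso τ σ
  go (_ ∷ _ ∷ _ ∷ _ ∷ [])    _  = no-occurrence
  go []                      ()
  go (_ ∷ [])                ()
  go (_ ∷ _ ∷ [])            ()
  go (_ ∷ _ ∷ _ ∷ [])        ()
  go (_ ∷ _ ∷ _ ∷ _ ∷ _ ∷ _) ()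

head∈init : ∀ U {c y z : ℕ} {zs} → (y ∷ z ∷ zs) ⊆ U ++ c ∷ [] → y ∈ U
head∈init []      (_ ∷ʳ ())
head∈init []      (_ ∷ ())
head∈init (u ∷ U) (_ ∷ʳ yz⊆) = there (head∈init U yz⊆)
head∈init (u ∷ U) (refl ∷ _) = here refl

<-before-last : ∀ {U c x y z zs} → AllPairs _<_ U → (x ∷ y ∷ z ∷ zs) ⊆ U ++ c ∷ [] → x < y
<-before-last {[]}    []        (_ ∷ʳ ())
<-before-last {[]}    []        (_ ∷ ())
<-before-last {u ∷ U} (_ ∷ U↑)  (_ ∷ʳ xyz⊆)  = <-before-last U↑ xyz⊆
<-before-last {u ∷ U} (u<U ∷ _) (refl ∷ yz⊆) = All.lookup u<U (head∈init U yz⊆)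

<-or-last : ∀ {U c x y} → AllPairs _<_ U → (x ∷ y ∷ []) ⊆ U ++ c ∷ [] → x < y ⊎ y ≡ c
<-or-last {[]}    []        (_ ∷ʳ ())
<-or-last {[]}    []        (_ ∷ ())
<-or-last {u ∷ U} (_ ∷ U↑)  (_ ∷ʳ xy⊆) = <-or-last U↑ xy⊆
<-or-last {u ∷ U} (u<U ∷ _) (refl ∷ y⊆) with ∈-++⁻ U (to∈ y⊆)
... | inj₁ y∈U        = inj₁ (All.lookup u<U y∈U)
... | inj₂ (here y≡c) = inj₂ y≡c

avoids-𝒫 : ∀ {a U c} → AllPairs _<_ U → a ≤ 2 + c → AvoidsAll (a ∷ U ++ c ∷ []) 𝒫
avoids-𝒫 {a} {U} {c} U↑ a≤2+c σ σ∈𝒫 = avoids-length-4 {σ = σ} (𝒫-lengths σ∈𝒫) (occurrence σ∈𝒫)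
  where
  middle-ascent : ∀ {x₀ x₁ x₂ x₃} → (x₀ ∷ x₁ ∷ x₂ ∷ x₃ ∷ []) ⊆ a ∷ U ++ c ∷ [] → x₁ < x₂
  middle-ascent (_ ∷ʳ τ⊆)   = <-before-last U↑ (∷ˡ⁻ τ⊆)
  middle-ascent (refl ∷ τ⊆) = <-before-last U↑ τ⊆

  occurrence : ∀ {σ} → σ ∈ 𝒫 → ∀ {x₀ x₁ x₂ x₃} → (x₀ ∷ x₁ ∷ x₂ ∷ x₃ ∷ []) ⊆ a ∷ U ++ c ∷ [] →
    ¬ OrderIso (x₀ ∷ x₁ ∷ x₂ ∷ x₃ ∷ []) σ
  occurrence 2413∈𝒫 τ⊆ τ≅σ = <-asym (middle-ascent τ⊆) (OrderIso-< τ≅σ (# 2) (# 1))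
  occurrence 2431∈𝒫 τ⊆ τ≅σ = <-asym (middle-ascent τ⊆) (OrderIso-< τ≅σ (# 2) (# 1))
  occurrence 4213∈𝒫 τ⊆ τ≅σ = <-asym (middle-ascent τ⊆) (OrderIso-< τ≅σ (# 2) (# 1))
  occurrence 3412∈𝒫 τ⊆ τ≅σ = <-asym (middle-ascent τ⊆) (OrderIso-< τ≅σ (# 2) (# 1))
  occurrence 3421∈𝒫 τ⊆ τ≅σ = <-asym (middle-ascent τ⊆) (OrderIso-< τ≅σ (# 2) (# 1))
  occurrence 4321∈𝒫 τ⊆ τ≅σ = <-asym (middle-ascent τ⊆) (OrderIso-< τ≅σ (# 2) (# 1))
  occurrence 4312∈𝒫 τ⊆ τ≅σ = <-asym (middle-ascent τ⊆) (OrderIso-< τ≅σ (# 2) (# 1))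
  occurrence 4231∈𝒫 (_ ∷ʳ τ⊆) τ≅σ = <-asym (<-before-last U↑ τ⊆) (OrderIso-< τ≅σ (# 1) (# 0))
  occurrence 4231∈𝒫 {x₁ = x₁} {x₂} (refl ∷ τ⊆) τ≅σ
    with <-or-last U↑ (⊆-trans (refl ∷ (_ ∷ʳ ⊆-refl)) τ⊆)
  ... | inj₁ x₁<x₃ = <-asym x₁<x₃ (OrderIso-< τ≅σ (# 3) (# 1))
  ... | inj₂ refl  = <⇒≱ 2+c<a a≤2+c
    where
    open ≤-Reasoning
    2+c<a : 2 + c < a
    2+c<a = begin-strict
      2 + c  <⟨ +-monoʳ-< 2 (OrderIso-< τ≅σ (# 3) (# 1)) ⟩
      2 + x₁ ≤⟨ s≤s (OrderIso-< τ≅σ (# 1) (# 2)) ⟩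
      1 + x₂ ≤⟨ OrderIso-< τ≅σ (# 2) (# 0) ⟩
      a      ∎
  occurrence (there (there (there (there (there (there (there (there ())))))))) _

special′ : ℕ → ℕ → Perm
special′ ℓ m = inflate σ41352 (I 1 ∷ I ℓ ∷ I 1 ∷ I m ∷ I 1 ∷ [])

special′-explicit : ∀ ℓ m →
  special′ ℓ m ≡ 3 + ℓ ∷ interval 0 ℓ ++ 2 + ℓ ∷ interval (3 + ℓ) m ++ 1 + ℓ ∷ []
special′-explicit ℓ m = trans (cong shifted (length-I ℓ)) reorder
  where
  -- special′ ℓ m unfolds definitionally to shifted (length (I ℓ)).
  shifted : ℕ → Perm
  shifted L = suc (L + 2) ∷ map (_+ 0) (I ℓ) ++ suc (L + 1) ∷ map (_+ suc (L + 2)) (I m) ++ suc (L + 0) ∷ []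

  reorder : shifted ℓ ≡ 3 + ℓ ∷ interval 0 ℓ ++ 2 + ℓ ∷ interval (3 + ℓ) m ++ 1 + ℓ ∷ []
  reorder rewrite +-comm ℓ 2 | +-comm ℓ 1 | +-identityʳ ℓ | I≡interval ℓ | I≡interval m
                | map-+-interval 0 0 ℓ | map-+-interval (3 + ℓ) 0 m = refl

rotate : ∀ (A B : List ℕ) a b c → a ∷ A ++ b ∷ B ++ c ∷ [] ↭ A ++ c ∷ b ∷ a ∷ B
rotate A B a b c = ↭-trans (↭-sym (shift a A (b ∷ B ++ c ∷ [])))
  (++⁺ˡ A (↭-trans (↭-prep a (↭-prep b (↭-sym (∷↭∷ʳ c B)))) reverse-three))
  where
  reverse-three : a ∷ b ∷ c ∷ B ↭ c ∷ b ∷ a ∷ B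
  reverse-three = ↭-trans (↭-swap a b ↭-refl) (↭-trans (↭-prep b (↭-swap a c ↭-refl)) (↭-swap b c ↭-refl))

special′-↭ : ∀ ℓ m → special′ ℓ m ↭ I (ℓ + (3 + m))
special′-↭ ℓ m = subst₂ _↭_ (sym (special′-explicit ℓ m)) sorted
  (rotate (interval 0 ℓ) (interval (3 + ℓ) m) (3 + ℓ) (2 + ℓ) (1 + ℓ))
  where
  sorted : interval 0 ℓ ++ 1 + ℓ ∷ 2 + ℓ ∷ 3 + ℓ ∷ interval (3 + ℓ) m ≡ I (ℓ + (3 + m))
  sorted = sym (trans (I≡interval (ℓ + (3 + m))) (interval-++ 0 ℓ (3 + m)))

length-special′ : ∀ ℓ m → length (special′ ℓ m) ≡ ℓ + (3 + m)
length-special′ ℓ m = trans (↭-length (special′-↭ ℓ m)) (length-I (ℓ + (3 + m)))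

special′-isPerm : ∀ ℓ m → IsPerm (special′ ℓ m)
special′-isPerm ℓ m = subst (λ k → special′ ℓ m ↭ I k) (sym (length-special′ ℓ m)) (special′-↭ ℓ m)

special′-injective : ∀ {ℓ m ℓ′ m′} → special′ ℓ m ≡ special′ ℓ′ m′ → ℓ ≡ ℓ′
special′-injective {ℓ} {m} {ℓ′} {m′} eq = +-cancelˡ-≡ 3 ℓ ℓ′ (∷-injectiveˡ (begin
  3 + ℓ ∷ _    ≡⟨ sym (special′-explicit ℓ m) ⟩
  special′ ℓ m   ≡⟨ eq ⟩
  special′ ℓ′ m′ ≡⟨ special′-explicit ℓ′ m′ ⟩
  3 + ℓ′ ∷ _   ∎))
  where open ≡-Reasoning

special′-isInflation : ∀ {ℓ m} → 1 ≤ ℓ → 1 ≤ m → IsInflationOf σ41352 (special′ ℓ m)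
special′-isInflation {ℓ} {m} 1≤ℓ 1≤m = _ , refl ,
  I-isPerm 1 ∷ I-isPerm ℓ ∷ I-isPerm 1 ∷ I-isPerm m ∷ I-isPerm 1 ∷ [] ,
  I-nonEmpty ≤-refl ∷ I-nonEmpty 1≤ℓ ∷ I-nonEmpty ≤-refl ∷ I-nonEmpty 1≤m ∷ I-nonEmpty ≤-refl ∷ [] ,
  refl

special′-avoids : ∀ ℓ m → AvoidsAll (special′ ℓ m) 𝒫
special′-avoids ℓ m = subst (λ π → AvoidsAll π 𝒫) (sym explicit) (avoids-𝒫 U↑ ≤-refl)
  where
  U : List ℕ
  U = interval 0 ℓ ++ 2 + ℓ ∷ interval (3 + ℓ) m

  explicit : special′ ℓ m ≡ 3 + ℓ ∷ U ++ 1 + ℓ ∷ []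
  explicit = trans (special′-explicit ℓ m) (cong (3 + ℓ ∷_) (sym (++-assoc (interval 0 ℓ) _ _)))

  below-2+ℓ : ∀ {x} → x ∈ interval 0 ℓ → x < 2 + ℓ
  below-2+ℓ x∈ = <-trans (s≤s (proj₂ (∈-interval⁻ 0 ℓ x∈))) (n<1+n (1 + ℓ))

  above-2+ℓ : ∀ {y} → y ∈ interval (3 + ℓ) m → 2 + ℓ < y
  above-2+ℓ y∈ = <-trans (n<1+n (2 + ℓ)) (proj₁ (∈-interval⁻ (3 + ℓ) m y∈))

  U↑ : AllPairs _<_ U
  U↑ = AllPairs.++⁺ (interval-increasing 0 ℓ)
    (All.tabulate above-2+ℓ ∷ interval-increasing (3 + ℓ) m)
    (All.tabulate (λ x∈ → below-2+ℓ x∈ ∷ All.tabulate (<-trans (below-2+ℓ x∈) ∘ above-2+ℓ)))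

length-decomposition : ∀ {n ℓ m} → ℓ + (3 + m) ≡ n → 1 ≤ m → m ≡ n ∸ ℓ ∸ 3 × ℓ ≤ n ∸ 4
length-decomposition {ℓ = ℓ} {m} refl 1≤m =
  sym (cong (_∸ 3) (m+n∸m≡n ℓ (3 + m))) ,
  m+n≤o⇒m≤o∸n ℓ (+-monoʳ-≤ ℓ (s≤s (s≤s (s≤s 1≤m))))

length-composition : ∀ {n ℓ} → 4 ≤ n → ℓ ≤ n ∸ 4 → ℓ + (3 + (n ∸ ℓ ∸ 3)) ≡ n × 1 ≤ n ∸ ℓ ∸ 3
length-composition {n} {ℓ} 4≤n ℓ≤n∸4 = length≡n , subst (1 ≤_) (sym (∸-+-assoc n ℓ 3)) (m<n⇒0<n∸m ℓ+3<n)
  where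
  ℓ+3<n : ℓ + 3 < n
  ℓ+3<n = subst (_≤ n) (+-suc ℓ 3) (m≤o∸n⇒m+n≤o ℓ 4≤n ℓ≤n∸4)

  open ≡-Reasoning
  length≡n : ℓ + (3 + (n ∸ ℓ ∸ 3)) ≡ n
  length≡n = begin
    ℓ + (3 + (n ∸ ℓ ∸ 3))   ≡⟨ cong (λ k → ℓ + (3 + k)) (∸-+-assoc n ℓ 3) ⟩
    ℓ + (3 + (n ∸ (ℓ + 3))) ≡⟨ sym (+-assoc ℓ 3 _) ⟩
    ℓ + 3 + (n ∸ (ℓ + 3))   ≡⟨ m+[n∸m]≡n (<⇒≤ ℓ+3<n) ⟩
    n                       ∎

module InflationOf41352
  {α₁ α₂ α₃ α₄ α₅ : Perm}
  (p₁ : IsPerm α₁) (p₂ : IsPerm α₂) (p₃ : IsPerm α₃) (p₄ : IsPerm α₄) (p₅ : IsPerm α₅)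
  (ne₁ : NonEmpty α₁) (ne₂ : NonEmpty α₂) (ne₃ : NonEmpty α₃) (ne₅ : NonEmpty α₅)
  (avoids : AvoidsAll (inflate σ41352 (α₁ ∷ α₂ ∷ α₃ ∷ α₄ ∷ α₅ ∷ [])) 𝒫)
  where

  L₁ L₂ L₃ L₄ L₅ : ℕ
  L₁ = length α₁
  L₂ = length α₂
  L₃ = length α₃
  L₄ = length α₄
  L₅ = length α₅

  -- The shifts that inflate gives the blocks α₁, α₃, α₄, α₅, in the form offset computes them;
  -- α₂ is shifted by 0.
  o₁ o₃ o₄ o₅ : ℕ
  o₁ = L₂ + (L₃ + (L₅ + 0))
  o₃ = L₂ + (L₅ + 0)
  o₄ = L₁ + o₁
  o₅ = L₂ + 0

  select : ∀ {s₁ s₂ s₃ s₄ s₅} → s₁ ⊆ α₁ → s₂ ⊆ α₂ → s₃ ⊆ α₃ → s₄ ⊆ α₄ → s₅ ⊆ α₅ →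
    map (_+ o₁) s₁ ++ map (_+ 0) s₂ ++ map (_+ o₃) s₃ ++ map (_+ o₄) s₄ ++ map (_+ o₅) s₅ ++ []
      ⊆ inflate σ41352 (α₁ ∷ α₂ ∷ α₃ ∷ α₄ ∷ α₅ ∷ [])
  select s₁ s₂ s₃ s₄ s₅ =
    ++⁺ (map⁺ _ s₁) (++⁺ (map⁺ _ s₂) (++⁺ (map⁺ _ s₃) (++⁺ (map⁺ _ s₄) (++⁺ (map⁺ _ s₅) []))))

  α₂<α₃ : ∀ {x y} → x ∈ α₂ → y ∈ α₃ → x + 0 < y + o₃
  α₂<α₃ x∈ y∈ = block-< p₂ p₃ x∈ y∈ (+-monoʳ-≤ L₂ z≤n)

  α₅<α₃ : ∀ {x y} → x ∈ α₅ → y ∈ α₃ → x + o₅ < y + o₃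
  α₅<α₃ x∈ y∈ = block-< p₅ p₃ x∈ y∈ (≤-reflexive (x∙yz≈y∙xz L₅ L₂ 0))

  α₃<α₁ : ∀ {x y} → x ∈ α₃ → y ∈ α₁ → x + o₃ < y + o₁
  α₃<α₁ x∈ y∈ = block-< p₃ p₁ x∈ y∈ (≤-reflexive (x∙yz≈y∙xz L₃ L₂ (L₅ + 0)))

  α₁<α₄ : ∀ {x y} → x ∈ α₁ → y ∈ α₄ → x + o₁ < y + o₄
  α₁<α₄ x∈ y∈ = block-< p₁ p₄ x∈ y∈ ≤-refl

  x₁ x₂ x₃ x₅ : ℕ
  x₁ = proj₁ (entry ne₁)
  x₂ = proj₁ (entry ne₂)
  x₃ = proj₁ (entry ne₃)
  x₅ = proj₁ (entry ne₅)

  x₁∈α₁ : x₁ ∈ α₁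
  x₁∈α₁ = proj₂ (entry ne₁)
  x₂∈α₂ : x₂ ∈ α₂
  x₂∈α₂ = proj₂ (entry ne₂)
  x₃∈α₃ : x₃ ∈ α₃
  x₃∈α₃ = proj₂ (entry ne₃)
  x₅∈α₅ : x₅ ∈ α₅
  x₅∈α₅ = proj₂ (entry ne₅)

  second∈ : ∀ {u v} {α : Perm} → (u ∷ v ∷ []) ⊆ α → v ∈ α
  second∈ = to∈ ∘ ∷ˡ⁻

  no-ascent₁ : ¬ Ascent α₁
  no-ascent₁ (u , v , uv⊆ , u<v) = ¬occurrence avoids 3412∈𝒫
    (α₂<α₃ x₂∈α₂ x₃∈α₃) (α₃<α₁ x₃∈α₃ (to∈ uv⊆)) (+-monoˡ-< o₁ u<v)
    (select uv⊆ (from∈ x₂∈α₂) (from∈ x₃∈α₃) (minimum _) (minimum _))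

  no-inversion₁ : ¬ Inversion α₁
  no-inversion₁ (u , v , uv⊆ , v<u) = ¬occurrence avoids 4312∈𝒫
    (α₂<α₃ x₂∈α₂ x₃∈α₃) (α₃<α₁ x₃∈α₃ (second∈ uv⊆)) (+-monoˡ-< o₁ v<u)
    (select uv⊆ (from∈ x₂∈α₂) (from∈ x₃∈α₃) (minimum _) (minimum _))

  no-inversion₂ : ¬ Inversion α₂
  no-inversion₂ (u , v , uv⊆ , v<u) = ¬occurrence avoids 4213∈𝒫
    (+-monoˡ-< 0 v<u) (α₂<α₃ (to∈ uv⊆) x₃∈α₃) (α₃<α₁ x₃∈α₃ x₁∈α₁)
    (select (from∈ x₁∈α₁) uv⊆ (from∈ x₃∈α₃) (minimum _) (minimum _))

  no-ascent₃ : ¬ Ascent α₃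
  no-ascent₃ (u , v , uv⊆ , u<v) = ¬occurrence avoids 4231∈𝒫
    (α₅<α₃ x₅∈α₅ (to∈ uv⊆)) (+-monoˡ-< o₃ u<v) (α₃<α₁ (second∈ uv⊆) x₁∈α₁)
    (select (from∈ x₁∈α₁) (minimum _) uv⊆ (minimum _) (from∈ x₅∈α₅))

  no-inversion₃ : ¬ Inversion α₃
  no-inversion₃ (u , v , uv⊆ , v<u) = ¬occurrence avoids 4321∈𝒫
    (α₅<α₃ x₅∈α₅ (second∈ uv⊆)) (+-monoˡ-< o₃ v<u) (α₃<α₁ (to∈ uv⊆) x₁∈α₁)
    (select (from∈ x₁∈α₁) (minimum _) uv⊆ (minimum _) (from∈ x₅∈α₅))

  no-inversion₄ : ¬ Inversion α₄
  no-inversion₄ (u , v , uv⊆ , v<u) = ¬occurrence avoids 2431∈𝒫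
    (<-trans (α₅<α₃ x₅∈α₅ x₃∈α₃) (α₃<α₁ x₃∈α₃ x₁∈α₁)) (α₁<α₄ x₁∈α₁ (second∈ uv⊆)) (+-monoˡ-< o₄ v<u)
    (select (from∈ x₁∈α₁) (minimum _) (minimum _) uv⊆ (from∈ x₅∈α₅))

  no-ascent₅ : ¬ Ascent α₅
  no-ascent₅ (u , v , uv⊆ , u<v) = ¬occurrence avoids 4312∈𝒫
    (+-monoˡ-< o₅ u<v) (α₅<α₃ (second∈ uv⊆) x₃∈α₃) (α₃<α₁ x₃∈α₃ x₁∈α₁)
    (select (from∈ x₁∈α₁) (minimum _) (from∈ x₃∈α₃) (minimum _) uv⊆)

  no-inversion₅ : ¬ Inversion α₅
  no-inversion₅ (u , v , uv⊆ , v<u) = ¬occurrence avoids 4321∈𝒫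
    (+-monoˡ-< o₅ v<u) (α₅<α₃ (to∈ uv⊆) x₃∈α₃) (α₃<α₁ x₃∈α₃ x₁∈α₁)
    (select (from∈ x₁∈α₁) (minimum _) (from∈ x₃∈α₃) (minimum _) uv⊆)

  blocks : α₁ ∷ α₂ ∷ α₃ ∷ α₄ ∷ α₅ ∷ [] ≡ I 1 ∷ I L₂ ∷ I 1 ∷ I L₄ ∷ I 1 ∷ []
  blocks =
    cong₂ List._∷_ (perm-singleton p₁ ne₁ no-ascent₁ no-inversion₁) (
    cong₂ List._∷_ (perm-without-inversion p₂ no-inversion₂) (
    cong₂ List._∷_ (perm-singleton p₃ ne₃ no-ascent₃ no-inversion₃) (
    cong₂ List._∷_ (perm-without-inversion p₄ no-inversion₄) (
    cong₂ List._∷_ (perm-singleton p₅ ne₅ no-ascent₅ no-inversion₅) refl))))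

  inflation≡special′ : inflate σ41352 (α₁ ∷ α₂ ∷ α₃ ∷ α₄ ∷ α₅ ∷ []) ≡ special′ L₂ L₄
  inflation≡special′ = cong (inflate σ41352) blocks

inflation-avoiding-𝒫 : ∀ {n π} → IsInflationOf σ41352 π → AvoidsAll π 𝒫 → length π ≡ n →
  ∃ λ ℓ → 1 ≤ ℓ × ℓ ≤ n ∸ 4 × π ≡ special n ℓ
inflation-avoiding-𝒫 {n}
  (α₁ ∷ α₂ ∷ α₃ ∷ α₄ ∷ α₅ ∷ [] , _ , p₁ ∷ p₂ ∷ p₃ ∷ p₄ ∷ p₅ ∷ [] , ne₁ ∷ ne₂ ∷ ne₃ ∷ ne₄ ∷ ne₅ ∷ [] , refl)
  avoids |π|≡n =
  L₂ , nonEmpty-length ne₂ , proj₂ decomposition ,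
  trans inflation≡special′ (cong (special′ L₂) (proj₁ decomposition))
  where
  open InflationOf41352 p₁ p₂ p₃ p₄ p₅ ne₁ ne₂ ne₃ ne₅ avoids

  decomposition : L₄ ≡ n ∸ L₂ ∸ 3 × L₂ ≤ n ∸ 4
  decomposition = length-decomposition
    (trans (sym (length-special′ L₂ L₄)) (trans (cong length (sym inflation≡special′)) |π|≡n))
    (nonEmpty-length ne₄)

mainTheorem14 : (n : ℕ) → 5 ≤ n →
    ((π : Perm) → IsPerm π → length π ≡ n →
      ((IsInflationOf σ41352 π × AvoidsAll π 𝒫) →
          ∃ λ ℓ → (1 ≤ ℓ) × (ℓ ≤ n ∸ 4) × (π ≡ special n ℓ))
      × ((∃ λ ℓ → (1 ≤ ℓ) × (ℓ ≤ n ∸ 4) × (π ≡ special n ℓ)) →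
          (IsInflationOf σ41352 π × AvoidsAll π 𝒫)))
    × ((ℓ : ℕ) → 1 ≤ ℓ → ℓ ≤ n ∸ 4 →
        IsPerm (special n ℓ) × (length (special n ℓ) ≡ n))
    × ((ℓ ℓ′ : ℕ) → 1 ≤ ℓ → ℓ ≤ n ∸ 4 → 1 ≤ ℓ′ → ℓ′ ≤ n ∸ 4 →
        special n ℓ ≡ special n ℓ′ → ℓ ≡ ℓ′)
mainTheorem14 n 5≤n =
  (λ π _ |π|≡n →
    (λ { (inflation , avoids) → inflation-avoiding-𝒫 inflation avoids |π|≡n }) ,
    (λ { (ℓ , 1≤ℓ , ℓ≤n∸4 , refl) →
      special′-isInflation 1≤ℓ (proj₂ (length-composition 4≤n ℓ≤n∸4)) , special′-avoids ℓ _ })) ,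
  (λ ℓ _ ℓ≤n∸4 → special′-isPerm ℓ _ , trans (length-special′ ℓ _) (proj₁ (length-composition 4≤n ℓ≤n∸4))) ,
  (λ _ _ _ _ _ _ → special′-injective)
  where
  4≤n : 4 ≤ n
  4≤n = <⇒≤ 5≤n
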